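{- Let $\phi$ be a unary strong normal form different from $\top$, written as \[ \phi=\bigwedge_{j\in J}\langle a_j\rangle\phi_j\land \bigwedge_{b\in A^l}[b]\bigvee_{k\in K_b}\psi^k_b , \] where $a_j\in A^r$ and every $\phi_j$ and every $\psi^k_b$ is a unary strong normal form. Then $\phi$ is represented by the process term defined recursively by \begin{eqnarray*} \theta(\phi) & = & \sum_{j\in J}a_j.\theta(\phi_j)+\sum_{b\in A^l}\sum_{k\in K_b}b.\theta(\psi^k_b),\quad\textrm{if $\phi\neq\top$} \\ \theta(\top) & = & \omega , \end{eqnarray*} i.e. for all $q\in\mathcal{P}$: $q\models\phi$ iff $\theta(\phi)\lesssim_{cc} q$. In particular $\phi$ is the characteristic formula for $\theta(\phi)$ (up to logical equivalence). Although the recursive definition of $\theta(\phi)$ formally contains a summand for each $b\in A^l$, only those $b$ with $K_b\neq\emptyset$ actually appear as summands of $\theta(\phi)$.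
   Context: Labelled transition systems $({\bf P},A,\to)$ with a finite set of actions $A=A^l\uplus A^r$ (no bivariant actions). A covariant-contravariant simulation is a relation $R$ such that whenever $p\,R\,q$: for all $a\in A^r$ and $p\xrightarrow{a}p'$ there is $q\xrightarrow{a}q'$ with $p'\,R\,q'$; and for all $a\in A^l$ and $q\xrightarrow{a}q'$ there is $p\xrightarrow{a}p'$ with $p'\,R\,q'$. $p\lesssim_{cc} q$ iff some such $R$ relates them. Process terms $\mathcal{P}$: $p::=0\mid\omega\mid a.p\mid p+p$ ($a\in A$), with rules $\omega\xrightarrow{b}\omega$ for all $b\in A^l$, $a.p\xrightarrow{a}p$, and $+$ as nondeterministic choice. The covariant-contravariant modal logic has syntax $\varphi::=\bot\mid\top\mid\varphi\land\varphi\mid\varphi\lor\varphi\mid[b]\varphi\mid\langle a\rangle\varphi$ ($a\in A^r$, $b\in A^l$), with $p\models[b]\varphi$ iff $p'\models\varphi$ for all $p\xrightarrow{b}p'$ and $p\models\langle a\rangle\varphi$ iff $p'\models\varphi$ for some $p\xrightarrow{a}p'$. A formula $\phi$ is represented by a process $p$ if for all $q\in\mathcal{P}$, $q\models\phi$ iff $p\lesssim_{cc}q$. A characteristic formula for $p$ is a $\phi$ with $p\models\phi$ and $q\models\phi\Rightarrow p\lesssim_{cc}q$ for all $q$. A formula is in strong normal form if it is a finite disjunction of unary strong normal forms; a formula is in unary strong normal form if it is $\top$ or of the form $\bigwedge_{j\in J}\langle a_j\rangle\phi_j\land\bigwedge_{b\in A^l}[b]\psi_b$ with each $\phi_j$ in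 unary strong normal form and each $\psi_b$ in strong normal form (equivalently $\psi_b=\bigvee_{k\in K_b}\psi^k_b$ with unary strong normal forms $\psi^k_b$). -}

module Defs where

open import Data.Nat using (ℕ)
open import Data.Fin using (Fin)
open import Data.Sum using (_⊎_; inj₁; inj₂)
open import Data.Product using (Σ; _×_; _,_)
open import Data.List using (List; []; _∷_; _++_; allFin)
open import Data.Empty using () renaming (⊥ to Empty)
open import Data.Unit using () renaming (⊤ to Unit)

-- Actions: A = A^l ⊎ A^r with A^l = Fin nl (contravariant), A^r = Fin nr (covariant).
module _ (nl nr : ℕ) where

  Act : Set
  Act = Fin nl ⊎ Fin nr

  data Proc : Set where
    𝟘   : Proc
    ω   : Proc
    _·_ : Act → Proc → Proc
    _⊕_ : Proc → Proc → Proc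

  infixr 6 _⊕_
  infixr 7 _·_

  data _—[_]→_ : Proc → Act → Proc → Set where
    ω-step : (b : Fin nl) → ω —[ inj₁ b ]→ ω
    pre    : (a : Act) (p : Proc) → (a · p) —[ a ]→ p
    sumˡ   : ∀ {p q a p'} → p —[ a ]→ p' → (p ⊕ q) —[ a ]→ p'
    sumʳ   : ∀ {p q a q'} → q —[ a ]→ q' → (p ⊕ q) —[ a ]→ q'

  record IsCCSim (R : Proc → Proc → Set) : Set where
    field
      cov  : ∀ {p q} → R p q → (a : Fin nr) → ∀ {p'} → p —[ inj₂ a ]→ p' →
             Σ Proc λ q' → (q —[ inj₂ a ]→ q') × R p' q'
      contra : ∀ {p q} → R p q → (b : Fin nl) → ∀ {q'} → q —[ inj₁ b ]→ q' →
             Σ Proc λ p' → (p —[ inj₁ b ]→ p') × R p' q'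

  _≲cc_ : Proc → Proc → Set₁
  p ≲cc q = Σ (Proc → Proc → Set) λ R → IsCCSim R × R p q

  data Form : Set where
    ⊥ᶠ ⊤ᶠ : Form
    _∧ᶠ_ _∨ᶠ_ : Form → Form → Form
    [_]ᶠ_ : Fin nl → Form → Form
    ⟨_⟩ᶠ_ : Fin nr → Form → Form

  _⊨_ : Proc → Form → Set
  p ⊨ ⊥ᶠ = Empty
  p ⊨ ⊤ᶠ = Unit
  p ⊨ (φ ∧ᶠ ψ) = (p ⊨ φ) × (p ⊨ ψ)
  p ⊨ (φ ∨ᶠ ψ) = (p ⊨ φ) ⊎ (p ⊨ ψ)
  p ⊨ ([ b ]ᶠ φ) = ∀ p' → p —[ inj₁ b ]→ p' → p' ⊨ φ
  p ⊨ (⟨ a ⟩ᶠ φ) = Σ Proc λ p' → (p —[ inj₂ a ]→ p') × (p' ⊨ φ)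

  ⋀ : List Form → Form
  ⋀ [] = ⊤ᶠ
  ⋀ (φ ∷ []) = φ
  ⋀ (φ ∷ ψ ∷ φs) = φ ∧ᶠ ⋀ (ψ ∷ φs)

  ⋁ : List Form → Form
  ⋁ [] = ⊥ᶠ
  ⋁ (φ ∷ []) = φ
  ⋁ (φ ∷ ψ ∷ φs) = φ ∨ᶠ ⋁ (ψ ∷ φs)

  Σₚ : List Proc → Proc
  Σₚ [] = 𝟘
  Σₚ (p ∷ []) = p
  Σₚ (p ∷ q ∷ ps) = p ⊕ Σₚ (q ∷ ps)

  -- Unary strong normal forms:
  --   top                represents ⊤
  --   node ds ks         represents ⋀_{(a_j,φ_j) ∈ ds} ⟨a_j⟩φ_j ∧ ⋀_{b ∈ A^l} [b] ⋁_{ψ ∈ ks b} ψ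
  data USNF : Set where
    top  : USNF
    node : List (Fin nr × USNF) → (Fin nl → List USNF) → USNF

  mutual
    ⟦_⟧ : USNF → Form
    ⟦ top ⟧ = ⊤ᶠ
    ⟦ node ds ks ⟧ = ⋀ (diaF ds ++ boxF ks (allFin nl))

    diaF : List (Fin nr × USNF) → List Form
    diaF [] = []
    diaF ((a , φ) ∷ ds) = (⟨ a ⟩ᶠ ⟦ φ ⟧) ∷ diaF ds

    disjF : List USNF → List Form
    disjF [] = []
    disjF (ψ ∷ ψs) = ⟦ ψ ⟧ ∷ disjF ψs

    boxF : (Fin nl → List USNF) → List (Fin nl) → List Form
    boxF ks [] = []
    boxF ks (b ∷ bs) = ([ b ]ᶠ ⋁ (disjF (ks b))) ∷ boxF ks bs

  mutual
    θ : USNF → Proc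
    θ top = ω
    θ (node ds ks) = Σₚ (diaP ds ++ boxP ks (allFin nl))

    diaP : List (Fin nr × USNF) → List Proc
    diaP [] = []
    diaP ((a , φ) ∷ ds) = (inj₂ a · θ φ) ∷ diaP ds

    boxP : (Fin nl → List USNF) → List (Fin nl) → List Proc
    boxP ks [] = []
    boxP ks (b ∷ bs) = sumK b (ks b) ++ boxP ks bs

    sumK : Fin nl → List USNF → List Proc
    sumK b [] = []
    sumK b (ψ ∷ ψs) = (inj₁ b · θ ψ) ∷ sumK b ψs

  RepresentedBy : Form → Proc → Set₁
  RepresentedBy φ p = ∀ q → ((q ⊨ φ) → p ≲cc q) × (p ≲cc q → q ⊨ φ)

  Characteristic : Form → Proc → Set₁
  Characteristic φ p = (p ⊨ φ) × (∀ q → q ⊨ φ → p ≲cc q)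

module Submission where

-- The proof works for every unary strong normal form, ⊤ included.
-- Completeness (q ⊨ ⟦ψ⟧ ⇒ θ ψ ≲cc q): the relation "p = θ ψ for some ψ with
-- q ⊨ ⟦ψ⟧" is a covariant-contravariant simulation.
-- Soundness (θ ψ ≲cc q ⇒ q ⊨ ⟦ψ⟧): structural induction on ψ, transporting the
-- transitions of θ ψ along the simulation.
-- Finally, representation always implies characterisation by reflexivity of ≲cc.

open import Data.Nat using (ℕ)
open import Data.Fin using (Fin)
open import Data.Product using (Σ; _×_; _,_; proj₁; proj₂)
open import Data.Sum using (inj₁; inj₂; [_,_])
open import Data.Unit using (tt)
open import Data.List using (List; []; _∷_; _++_; allFin)
open import Data.List.Relation.Unary.All using (All; []; _∷_; lookup)
open import Data.List.Relation.Unary.Any using (Any; here; there)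
import Data.List.Relation.Unary.All.Properties as All
import Data.List.Relation.Unary.Any.Properties as Any
open import Data.List.Membership.Propositional using (_∈_)
open import Data.List.Membership.Propositional.Properties using (∈-allFin)
open import Relation.Binary.PropositionalEquality using (_≡_; refl)
import Defs as D

module Representation (nl nr : ℕ) where

  open D using (ω; ω-step; pre; sumˡ; sumʳ; [_]ᶠ_; ⟨_⟩ᶠ_; top; node)
  open D.IsCCSim using (cov; contra)

  Proc : Set
  Proc = D.Proc nl nr

  Act : Set
  Act = D.Act nl nr

  Form : Set
  Form = D.Form nl nr

  USNF : Set
  USNF = D.USNF nl nr

  _—[_]→_ : Proc → Act → Proc → Set
  _—[_]→_ = D._—[_]→_ nl nr

  IsCCSim : (Proc → Proc → Set) → Set
  IsCCSim = D.IsCCSim nl nr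

  _≲cc_ : Proc → Proc → Set₁
  _≲cc_ = D._≲cc_ nl nr

  _⊨_ : Proc → Form → Set
  _⊨_ = D._⊨_ nl nr

  ⋀ ⋁ : List Form → Form
  ⋀ = D.⋀ nl nr
  ⋁ = D.⋁ nl nr

  Σₚ : List Proc → Proc
  Σₚ = D.Σₚ nl nr

  ⟦_⟧ : USNF → Form
  ⟦_⟧ = D.⟦_⟧ nl nr

  θ : USNF → Proc
  θ = D.θ nl nr

  RepresentedBy Characteristic : Form → Proc → Set₁
  RepresentedBy = D.RepresentedBy nl nr
  Characteristic = D.Characteristic nl nr

  ⋀-sat⁻ : ∀ {q} (φs : List Form) → q ⊨ ⋀ φs → All (q ⊨_) φs
  ⋀-sat⁻ [] _ = []
  ⋀-sat⁻ (φ ∷ []) x = x ∷ []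
  ⋀-sat⁻ (φ ∷ ψ ∷ φs) (x , xs) = x ∷ ⋀-sat⁻ (ψ ∷ φs) xs

  ⋀-sat⁺ : ∀ {q} (φs : List Form) → All (q ⊨_) φs → q ⊨ ⋀ φs
  ⋀-sat⁺ [] [] = tt
  ⋀-sat⁺ (φ ∷ []) (x ∷ []) = x
  ⋀-sat⁺ (φ ∷ ψ ∷ φs) (x ∷ xs) = x , ⋀-sat⁺ (ψ ∷ φs) xs

  ⋁-sat⁻ : ∀ {q} (φs : List Form) → q ⊨ ⋁ φs → Any (q ⊨_) φs
  ⋁-sat⁻ (φ ∷ []) x = here x
  ⋁-sat⁻ (φ ∷ ψ ∷ φs) (inj₁ x) = here x
  ⋁-sat⁻ (φ ∷ ψ ∷ φs) (inj₂ x) = there (⋁-sat⁻ (ψ ∷ φs) x)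

  ⋁-sat⁺ : ∀ {q} (φs : List Form) → Any (q ⊨_) φs → q ⊨ ⋁ φs
  ⋁-sat⁺ (φ ∷ []) (here x) = x
  ⋁-sat⁺ (φ ∷ ψ ∷ φs) (here x) = inj₁ x
  ⋁-sat⁺ (φ ∷ ψ ∷ φs) (there x) = inj₂ (⋁-sat⁺ (ψ ∷ φs) x)

  Σₚ-step⁻ : ∀ {c p'} (ps : List Proc) → Σₚ ps —[ c ]→ p' → Any (_—[ c ]→ p') ps
  Σₚ-step⁻ (p ∷ []) s = here s
  Σₚ-step⁻ (p ∷ q ∷ ps) (sumˡ s) = here s
  Σₚ-step⁻ (p ∷ q ∷ ps) (sumʳ s) = there (Σₚ-step⁻ (q ∷ ps) s)

  Σₚ-step⁺ : ∀ {c p'} (ps : List Proc) → Any (_—[ c ]→ p') ps → Σₚ ps —[ c ]→ p'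
  Σₚ-step⁺ (p ∷ []) (here s) = s
  Σₚ-step⁺ (p ∷ q ∷ ps) (here s) = sumˡ s
  Σₚ-step⁺ (p ∷ q ∷ ps) (there s) = sumʳ (Σₚ-step⁺ (q ∷ ps) s)

  ≲cc-refl : ∀ p → p ≲cc p
  ≲cc-refl p = _≡_ , identity-sim , refl
    where
      identity-sim : IsCCSim _≡_
      cov identity-sim refl a {p'} s = p' , s , refl
      contra identity-sim refl b {q'} s = q' , s , refl

  represented⇒characteristic : ∀ {φ p} → RepresentedBy φ p → Characteristic φ p
  represented⇒characteristic {p = p} rep =
    proj₂ (rep p) (≲cc-refl p) , λ q → proj₁ (rep q)

  data NodeStep (ds : List (Fin nr × USNF)) (ks : Fin nl → List USNF) : Act → Proc → Set where
    dia : ∀ {a φ} → (a , φ) ∈ ds → NodeStep ds ks (inj₂ a) (θ φ)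
    box : ∀ {b ψ} → ψ ∈ ks b → NodeStep ds ks (inj₁ b) (θ ψ)

  diaP-step⁻ : ∀ {ds ks c p'} (es : List (Fin nr × USNF)) → (∀ {e} → e ∈ es → e ∈ ds) →
               Any (_—[ c ]→ p') (D.diaP nl nr es) → NodeStep ds ks c p'
  diaP-step⁻ (_ ∷ es) incl (here (pre _ _)) = dia (incl (here refl))
  diaP-step⁻ (_ ∷ es) incl (there s) = diaP-step⁻ es (λ m → incl (there m)) s

  sumK-step⁻ : ∀ {ds ks b c p'} (ψs : List USNF) → (∀ {ψ} → ψ ∈ ψs → ψ ∈ ks b) →
               Any (_—[ c ]→ p') (D.sumK nl nr b ψs) → NodeStep ds ks c p'
  sumK-step⁻ (_ ∷ ψs) incl (here (pre _ _)) = box (incl (here refl))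
  sumK-step⁻ (_ ∷ ψs) incl (there s) = sumK-step⁻ ψs (λ m → incl (there m)) s

  boxP-step⁻ : ∀ {ds ks c p'} (bs : List (Fin nl)) →
               Any (_—[ c ]→ p') (D.boxP nl nr ks bs) → NodeStep ds ks c p'
  boxP-step⁻ {ks = ks} (b ∷ bs) s =
    [ sumK-step⁻ (ks b) (λ m → m) , boxP-step⁻ bs ] (Any.++⁻ (D.sumK nl nr b (ks b)) s)

  node-step⁻ : ∀ {c p'} ds ks → θ (node ds ks) —[ c ]→ p' → NodeStep ds ks c p'
  node-step⁻ ds ks s =
    [ diaP-step⁻ ds (λ m → m) , boxP-step⁻ (allFin nl) ]
      (Any.++⁻ (D.diaP nl nr ds) (Σₚ-step⁻ (D.diaP nl nr ds ++ D.boxP nl nr ks (allFin nl)) s))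

  diaP-step⁺ : ∀ {a φ} (ds : List (Fin nr × USNF)) → (a , φ) ∈ ds →
               Any (_—[ inj₂ a ]→ θ φ) (D.diaP nl nr ds)
  diaP-step⁺ (_ ∷ ds) (here refl) = here (pre _ _)
  diaP-step⁺ (_ ∷ ds) (there m) = there (diaP-step⁺ ds m)

  sumK-step⁺ : ∀ {b ψ} (ψs : List USNF) → ψ ∈ ψs → Any (_—[ inj₁ b ]→ θ ψ) (D.sumK nl nr b ψs)
  sumK-step⁺ (_ ∷ ψs) (here refl) = here (pre _ _)
  sumK-step⁺ (_ ∷ ψs) (there m) = there (sumK-step⁺ ψs m)

  boxP-step⁺ : ∀ {b ψ} ks (bs : List (Fin nl)) → b ∈ bs → ψ ∈ ks b →
               Any (_—[ inj₁ b ]→ θ ψ) (D.boxP nl nr ks bs)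
  boxP-step⁺ ks (b ∷ bs) (here refl) m = Any.++⁺ˡ (sumK-step⁺ (ks b) m)
  boxP-step⁺ ks (b ∷ bs) (there mb) m = Any.++⁺ʳ (D.sumK nl nr b (ks b)) (boxP-step⁺ ks bs mb m)

  node-step⁺ : ∀ {c p'} ds ks → NodeStep ds ks c p' → θ (node ds ks) —[ c ]→ p'
  node-step⁺ ds ks (dia m) =
    Σₚ-step⁺ (D.diaP nl nr ds ++ _) (Any.++⁺ˡ (diaP-step⁺ ds m))
  node-step⁺ ds ks (box {b} m) =
    Σₚ-step⁺ (D.diaP nl nr ds ++ _) (Any.++⁺ʳ (D.diaP nl nr ds) (boxP-step⁺ ks (allFin nl) (∈-allFin b) m))

  record SatNode (q : Proc) (ds : List (Fin nr × USNF)) (ks : Fin nl → List USNF) : Set where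
    constructor satNode
    field
      diamonds : ∀ {a φ} → (a , φ) ∈ ds → q ⊨ (⟨ a ⟩ᶠ ⟦ φ ⟧)
      boxes    : ∀ b {q'} → q —[ inj₁ b ]→ q' → Σ USNF λ ψ → (ψ ∈ ks b) × (q' ⊨ ⟦ ψ ⟧)

  diaF-sat⁻ : ∀ {q a φ} (ds : List (Fin nr × USNF)) →
              All (q ⊨_) (D.diaF nl nr ds) → (a , φ) ∈ ds → q ⊨ (⟨ a ⟩ᶠ ⟦ φ ⟧)
  diaF-sat⁻ (_ ∷ ds) (x ∷ _) (here refl) = x
  diaF-sat⁻ (_ ∷ ds) (_ ∷ xs) (there m) = diaF-sat⁻ ds xs m

  diaF-sat⁺ : ∀ {q} (ds : List (Fin nr × USNF)) →
              (∀ {a φ} → (a , φ) ∈ ds → q ⊨ (⟨ a ⟩ᶠ ⟦ φ ⟧)) → All (q ⊨_) (D.diaF nl nr ds)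
  diaF-sat⁺ [] _ = []
  diaF-sat⁺ (_ ∷ ds) x = x (here refl) ∷ diaF-sat⁺ ds (λ m → x (there m))

  boxF-sat⁻ : ∀ {q b} ks (bs : List (Fin nl)) → All (q ⊨_) (D.boxF nl nr ks bs) → b ∈ bs →
              q ⊨ ([ b ]ᶠ ⋁ (D.disjF nl nr (ks b)))
  boxF-sat⁻ ks (_ ∷ bs) (x ∷ _) (here refl) = x
  boxF-sat⁻ ks (_ ∷ bs) (_ ∷ xs) (there m) = boxF-sat⁻ ks bs xs m

  boxF-sat⁺ : ∀ {q} ks (bs : List (Fin nl)) →
              (∀ b → q ⊨ ([ b ]ᶠ ⋁ (D.disjF nl nr (ks b)))) → All (q ⊨_) (D.boxF nl nr ks bs)
  boxF-sat⁺ ks [] _ = []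
  boxF-sat⁺ ks (b ∷ bs) x = x b ∷ boxF-sat⁺ ks bs x

  disjF-sat⁻ : ∀ {q} (ψs : List USNF) → Any (q ⊨_) (D.disjF nl nr ψs) →
               Σ USNF λ ψ → (ψ ∈ ψs) × (q ⊨ ⟦ ψ ⟧)
  disjF-sat⁻ (ψ ∷ ψs) (here x) = ψ , here refl , x
  disjF-sat⁻ (ψ ∷ ψs) (there x) with disjF-sat⁻ ψs x
  ... | χ , m , y = χ , there m , y

  disjF-sat⁺ : ∀ {q ψ} (ψs : List USNF) → ψ ∈ ψs → q ⊨ ⟦ ψ ⟧ → Any (q ⊨_) (D.disjF nl nr ψs)
  disjF-sat⁺ (_ ∷ ψs) (here refl) x = here x
  disjF-sat⁺ (_ ∷ ψs) (there m) x = there (disjF-sat⁺ ψs m x)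

  node-sat⁻ : ∀ {q} ds ks → q ⊨ ⟦ node ds ks ⟧ → SatNode q ds ks
  node-sat⁻ {q} ds ks x
    with All.++⁻ (D.diaF nl nr ds) (⋀-sat⁻ (D.diaF nl nr ds ++ D.boxF nl nr ks (allFin nl)) x)
  ... | dia-sat , box-sat = satNode (diaF-sat⁻ ds dia-sat) boxes
    where
      boxes : ∀ b {q'} → q —[ inj₁ b ]→ q' → Σ USNF λ ψ → (ψ ∈ ks b) × (q' ⊨ ⟦ ψ ⟧)
      boxes b s = disjF-sat⁻ (ks b) (⋁-sat⁻ _ (boxF-sat⁻ ks (allFin nl) box-sat (∈-allFin b) _ s))

  node-sat⁺ : ∀ {q} ds ks → SatNode q ds ks → q ⊨ ⟦ node ds ks ⟧
  node-sat⁺ {q} ds ks (satNode diamonds boxes) =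
    ⋀-sat⁺ (D.diaF nl nr ds ++ _) (All.++⁺ (diaF-sat⁺ ds diamonds) (boxF-sat⁺ ks (allFin nl) box-sat))
    where
      box-sat : ∀ b → q ⊨ ([ b ]ᶠ ⋁ (D.disjF nl nr (ks b)))
      box-sat b q' s with boxes b s
      ... | ψ , m , y = ⋁-sat⁺ _ (disjF-sat⁺ (ks b) m y)

  Witnessed : Proc → Proc → Set
  Witnessed p q = Σ USNF λ ψ → (θ ψ ≡ p) × (q ⊨ ⟦ ψ ⟧)

  -- Covariant steps of θ ψ are answered by the diamonds ψ asserts of q; contravariant
  -- steps of q are answered via the boxes (or by ω's self-loop when ψ = ⊤).
  witnessed-sim : IsCCSim Witnessed
  cov witnessed-sim (top , refl , _) a ()
  cov witnessed-sim (node ds ks , refl , x) a s with node-step⁻ ds ks s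
  ... | dia {φ = φ} m with SatNode.diamonds (node-sat⁻ ds ks x) m
  ...   | q' , s' , y = q' , s' , φ , refl , y
  contra witnessed-sim (top , refl , _) b s = ω , ω-step b , top , refl , tt
  contra witnessed-sim (node ds ks , refl , x) b s with SatNode.boxes (node-sat⁻ ds ks x) b s
  ... | ψ , m , y = θ ψ , node-step⁺ ds ks (box m) , ψ , refl , y

  complete : ∀ ψ {q} → q ⊨ ⟦ ψ ⟧ → θ ψ ≲cc q
  complete ψ x = Witnessed , witnessed-sim , ψ , refl , x

  Sound : USNF → Set₁
  Sound ψ = ∀ {q} → θ ψ ≲cc q → q ⊨ ⟦ ψ ⟧

  -- Induction step: a simulation R with R (θ(node ds ks)) q carries each diamond
  -- step of θ(node ds ks) to q, and pulls each b-step of q back to a step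
  -- b → θ ψ with ψ ∈ ks b; the induction hypotheses finish both cases.
  sound-node : ∀ {ds ks} → All (λ d → Sound (proj₂ d)) ds → (∀ b → All Sound (ks b)) →
               Sound (node ds ks)
  sound-node {ds} {ks} ih-dia ih-box {q} (R , sim , r) = node-sat⁺ ds ks (satNode diamonds boxes)
    where
      diamonds : ∀ {a φ} → (a , φ) ∈ ds → q ⊨ (⟨ a ⟩ᶠ ⟦ φ ⟧)
      diamonds {a} m with cov sim r a (node-step⁺ ds ks (dia m))
      ... | q' , s , r' = q' , s , lookup ih-dia m (R , sim , r')

      boxes : ∀ b {q'} → q —[ inj₁ b ]→ q' → Σ USNF λ ψ → (ψ ∈ ks b) × (q' ⊨ ⟦ ψ ⟧)
      boxes b s with contra sim r b s
      ... | p' , s' , r' with node-step⁻ ds ks s'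
      ...   | box {ψ = ψ} m = ψ , m , lookup (ih-box b) m (R , sim , r')

  mutual
    sound : ∀ ψ → Sound ψ
    sound top _ = tt
    sound (node ds ks) = sound-node (sound-diamonds ds) (λ b → sound-all (ks b))

    sound-diamonds : ∀ (ds : List (Fin nr × USNF)) → All (λ d → Sound (proj₂ d)) ds
    sound-diamonds [] = []
    sound-diamonds ((_ , φ) ∷ ds) = sound φ ∷ sound-diamonds ds

    sound-all : ∀ (ψs : List USNF) → All Sound ψs
    sound-all [] = []
    sound-all (ψ ∷ ψs) = sound ψ ∷ sound-all ψs

  θ-represents : ∀ ψ → RepresentedBy ⟦ ψ ⟧ (θ ψ)
  θ-represents ψ q = complete ψ , sound ψ

open import Defs using (USNF; node; ⟦_⟧; θ; RepresentedBy; Characteristic)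

theorem12 : (nl nr : ℕ) (ds : List (Fin nr × USNF nl nr)) (ks : Fin nl → List (USNF nl nr)) →
    RepresentedBy nl nr (⟦_⟧ nl nr (node ds ks)) (θ nl nr (node ds ks))
    × Characteristic nl nr (⟦_⟧ nl nr (node ds ks)) (θ nl nr (node ds ks))
theorem12 nl nr ds ks = represents , represented⇒characteristic represents
  where
    open Representation nl nr using (θ-represents; represented⇒characteristic)
    represents : RepresentedBy nl nr (⟦_⟧ nl nr (node ds ks)) (θ nl nr (node ds ks))
    represents = θ-represents (node ds ks)
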